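{- Let $n\ge2$, let $\pi\in S_n$ with $\pi_1=n$ or $\pi_1=n-1$, and let $k$ be an integer. Put $\pi'=T^{k}(\pi)$, $\pi''=T^{ -k}(\pi)$, $\pi'''=T^{ -k+2}(\pi)$. Then: (1) $\pi'_i=\pi''_i$ for $1\le i\le \pi'_1$, and $\pi'_{i}=\pi''_{n+\pi'_1+1-i}$ for $\pi'_1+1\le i\le n$; that is, $\pi'$ and $\pi''$ have the same first $\pi'_1$ entries, while the last $n-\pi'_1$ entries of $\pi'$ are those of $\pi''$ in reverse order. (2) $\pi'_i=\pi'''_{n-\pi'_n+1-i}$ for $1\le i\le n-\pi'_n$, and $\pi'_i=\pi'''_i$ for $n-\pi'_n+1\le i\le n$; that is, $\pi'$ and $\pi'''$ have the same last $\pi'_n$ entries, while the first $n-\pi'_n$ entries of $\pi'$ are those of $\pi'''$ in reverse order.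
   Context: Permutations are in one-line notation $\pi=\pi_1\cdots\pi_n$. The topdrop map $T:S_n\to S_n$ is $T(\pi_1\cdots\pi_n)=\pi_{\pi_1+1}\cdots\pi_n\,\pi_{\pi_1}\pi_{\pi_1-1}\cdots\pi_1$ (first $\pi_1$ entries removed, reversed, appended at the end); it is a bijection, and $T^{k}$ for an integer $k$ denotes the $|k|$-fold iterate of $T$ (if $k\ge0$) or of $T^{ -1}$ (if $k<0$). -}

module Defs where

open import Data.Nat using (ℕ; zero; suc; _∸_)
open import Data.Integer using (ℤ; +_; -[1+_])
open import Data.List using (List; []; _∷_; _++_; take; drop; reverse; length; map; upTo)
open import Data.List.Relation.Binary.Permutation.Propositional using (_↭_)
open import Function using (_∘_)

IsPerm : ℕ → List ℕ → Set
IsPerm n π = π ↭ map suc (upTo n)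

-- 1-based entry π_i (returns 0 outside the range 1..length π; never used there below).
entry : List ℕ → ℕ → ℕ
entry []       _             = 0
entry (x ∷ xs) zero          = 0
entry (x ∷ xs) (suc zero)    = x
entry (x ∷ xs) (suc (suc i)) = entry xs (suc i)

T : List ℕ → List ℕ
T π = drop (entry π 1) π ++ reverse (take (entry π 1) π)

-- inverse of topdrop: the last entry σ_n equals π_1 = m; the last m entries of σ,
-- reversed, are the first m entries of π, followed by the first n - m entries of σ.
Tinv : List ℕ → List ℕ
Tinv σ = reverse (drop (length σ ∸ entry σ (length σ)) σ) ++ take (length σ ∸ entry σ (length σ)) σ

iter : (List ℕ → List ℕ) → ℕ → List ℕ → List ℕ
iter f zero    = λ x → x
iter f (suc m) = f ∘ iter f m

Tpow : ℤ → List ℕ → List ℕ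
Tpow (+ m)      = iter T m
Tpow -[1+ m ]   = iter Tinv (suc m)

{-# OPTIONS --safe #-}
-- Tinv is reverse ∘ T ∘ reverse, and on permutations T ∘ reverse ∘ T = reverse: after
-- reversing T σ, its first σ₁ entries are again the original first block, with σ₁ in front,
-- so T puts them back.  When π₁ ∈ {n, n - 1} we have T π = reverse π, hence conjugating by
-- reverse gives T^(-k) π = reverse (T π′) and T^(2-k) π = T (reverse π′) for π′ = T^k π.
-- Finally reverse ∘ T reverses the entries of σ after position σ₁, and T ∘ reverse reverses
-- its first n - σₙ entries; these are statements (1) and (2).
module Submission where

open import Defs
open import Data.Integer using (ℤ; +_; -[1+_]; 1ℤ) renaming (_+_ to _+ℤ_; -_ to -ℤ_)
import Data.Integer.Properties as ℤ
open import Data.List using (List; []; _∷_; _++_; take; drop; reverse; length; map; upTo)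
open import Data.List.Properties
  using (length-take; length-drop; length-reverse; take++drop≡id; take-all; drop-all;
         reverse-++; reverse-involutive; unfold-reverse; length-++; length-map; length-upTo)
open import Data.List.Membership.Propositional.Properties using (∈-map⁻; ∈-upTo⁻)
open import Data.List.Relation.Unary.Any using (here)
open import Data.List.Relation.Binary.Permutation.Propositional using (_↭_; ↭-trans; ↭-reflexive; module PermutationReasoning)
open import Data.List.Relation.Binary.Permutation.Propositional.Properties
  using (∈-resp-↭; ↭-length; ↭-reverse; ++-comm; ++⁺ˡ)
open import Data.Nat using (ℕ; zero; suc; _+_; _∸_; _≤_; _<_; z≤n; s≤s; _≤?_)
open import Data.Nat.Properties
open import Data.Product using (_×_; _,_; proj₁; proj₂)
open import Data.Sum using (_⊎_; inj₁; inj₂)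
open import Relation.Nullary using (yes; no)
open import Function using (_∘_)
open import Relation.Binary.PropositionalEquality

m∸n+n∸o≡m∸o : ∀ {m n o} → o ≤ n → n ≤ m → (m ∸ n) + (n ∸ o) ≡ m ∸ o
m∸n+n∸o≡m∸o z≤n n≤m = m∸n+n≡m n≤m
m∸n+n∸o≡m∸o {suc m} (s≤s o≤n) (s≤s n≤m) = m∸n+n∸o≡m∸o o≤n n≤m

entry-zero : ∀ xs → entry xs 0 ≡ 0
entry-zero []      = refl
entry-zero (_ ∷ _) = refl

entry-∷ : ∀ x xs {i} → 1 ≤ i → entry (x ∷ xs) (suc i) ≡ entry xs i
entry-∷ x xs {suc i} _ = refl

entry-beyond : ∀ xs {i} → length xs < i → entry xs i ≡ 0
entry-beyond []       _                      = refl
entry-beyond (x ∷ xs) {suc (suc i)} (s≤s lt) = entry-beyond xs lt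

entry-++ˡ : ∀ xs ys {i} → i ≤ length xs → entry (xs ++ ys) i ≡ entry xs i
entry-++ˡ []       ys {zero}          _        = entry-zero ys
entry-++ˡ (x ∷ xs) ys {zero}          _        = refl
entry-++ˡ (x ∷ xs) ys {suc zero}      _        = refl
entry-++ˡ (x ∷ xs) ys {suc (suc i)}   (s≤s le) = entry-++ˡ xs ys le

entry-++ʳ : ∀ xs ys {i} → 1 ≤ i → entry (xs ++ ys) (length xs + i) ≡ entry ys i
entry-++ʳ []       ys _   = refl
entry-++ʳ (x ∷ xs) ys {i} 1≤i =
  trans (entry-∷ x (xs ++ ys) (≤-trans 1≤i (m≤n+m i (length xs)))) (entry-++ʳ xs ys 1≤i)

entry-reverse : ∀ xs {i j} → i + j ≡ suc (length xs) → entry (reverse xs) i ≡ entry xs j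
entry-reverse []       _ = refl
entry-reverse (x ∷ xs) {i} {j} i+j≡ rewrite unfold-reverse x xs = go j i+j≡
  where
  |rxs| = length-reverse xs

  peel : ∀ {j n} → i + suc j ≡ suc n → i + j ≡ n
  peel {j} e = suc-injective (trans (sym (+-suc i j)) e)

  go : ∀ j → i + j ≡ suc (suc (length xs)) → entry (reverse xs ++ x ∷ []) i ≡ entry (x ∷ xs) j
  go zero          e = entry-beyond (reverse xs ++ x ∷ []) (begin-strict
      length (reverse xs ++ x ∷ [])   ≡⟨ length-++ (reverse xs) ⟩
      length (reverse xs) + 1         ≡⟨ cong (_+ 1) |rxs| ⟩
      length xs + 1                   <⟨ ≤-reflexive (cong suc (+-comm (length xs) 1)) ⟩
      suc (suc (length xs))           ≡⟨ trans (sym (+-identityʳ i)) e ⟨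
      i                               ∎)
    where open ≤-Reasoning
  go (suc zero)    e = begin
      entry (reverse xs ++ x ∷ []) i                         ≡⟨ cong (entry (reverse xs ++ x ∷ [])) i≡ ⟩
      entry (reverse xs ++ x ∷ []) (length (reverse xs) + 1) ≡⟨ entry-++ʳ (reverse xs) (x ∷ []) ≤-refl ⟩
      x                                                      ∎
    where
    open ≡-Reasoning
    i≡ : i ≡ length (reverse xs) + 1
    i≡ = trans (sym (+-identityʳ i)) (trans (peel e) (trans (cong suc (sym |rxs|)) (+-comm 1 _)))
  go (suc (suc j)) e = trans (entry-++ˡ (reverse xs) (x ∷ []) i≤) (entry-reverse xs (peel e))
    where
    i≤ : i ≤ length (reverse xs)
    i≤ = ≤-trans (m≤m+n i j) (≤-reflexive (trans (peel (peel e)) (sym |rxs|)))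

entry-take : ∀ m σ {i} → i ≤ m → entry (take m σ) i ≡ entry σ i
entry-take zero    σ        {zero}        _        = sym (entry-zero σ)
entry-take (suc m) []                     _        = refl
entry-take (suc m) (x ∷ σ)  {zero}        _        = refl
entry-take (suc m) (x ∷ σ)  {suc zero}    _        = refl
entry-take (suc m) (x ∷ σ)  {suc (suc i)} (s≤s le) = entry-take m σ le

entry-drop : ∀ m σ {j} → 1 ≤ j → entry (drop m σ) j ≡ entry σ (m + j)
entry-drop zero    σ       _   = refl
entry-drop (suc m) []      _   = refl
entry-drop (suc m) (x ∷ σ) {j} 1≤j =
  trans (entry-drop m σ 1≤j) (sym (entry-∷ x σ (≤-trans 1≤j (m≤n+m j m))))

length-take-≤ : ∀ {m} (σ : List ℕ) → m ≤ length σ → length (take m σ) ≡ m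
length-take-≤ {m} σ m≤ = trans (length-take m σ) (m≤n⇒m⊓n≡m m≤)

reverseSuffix : ℕ → List ℕ → List ℕ
reverseSuffix m σ = take m σ ++ reverse (drop m σ)

reversePrefix : ℕ → List ℕ → List ℕ
reversePrefix m σ = reverse (take m σ) ++ drop m σ

module _ (σ : List ℕ) {m : ℕ} (m≤ : m ≤ length σ) where
  private
    A = take m σ
    B = drop m σ
    N = length σ

    |A| : length A ≡ m
    |A| = length-take-≤ σ m≤

    |rA| : length (reverse A) ≡ m
    |rA| = trans (length-reverse A) |A|

    m+1≤⇒m< : ∀ {i} → m + 1 ≤ i → m < i
    m+1≤⇒m< = ≤-trans (≤-reflexive (+-comm 1 m))

    entry-past : ∀ {i} → m + 1 ≤ i → entry B (i ∸ m) ≡ entry σ i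
    entry-past m+1≤i = trans (entry-drop m σ (m<n⇒0<n∸m m<i)) (cong (entry σ) (m+[n∸m]≡n (<⇒≤ m<i)))
      where m<i = m+1≤⇒m< m+1≤i

  open ≡-Reasoning

  entry-reverseSuffix-≤ : ∀ {i} → i ≤ m → entry (reverseSuffix m σ) i ≡ entry σ i
  entry-reverseSuffix-≤ {i} i≤m =
    trans (entry-++ˡ A (reverse B) (≤-trans i≤m (≤-reflexive (sym |A|)))) (entry-take m σ i≤m)

  entry-reverseSuffix-> : ∀ {i} → m + 1 ≤ i → i ≤ N →
                          entry (reverseSuffix m σ) (N + m + 1 ∸ i) ≡ entry σ i
  entry-reverseSuffix-> {i} m+1≤i i≤N = begin
      entry (A ++ reverse B) (N + m + 1 ∸ i)   ≡⟨ cong (entry (A ++ reverse B)) index ⟩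
      entry (A ++ reverse B) (length A + s)    ≡⟨ entry-++ʳ A (reverse B) (m<n⇒0<n∸m i<N+1) ⟩
      entry (reverse B) s                      ≡⟨ entry-reverse B s+j≡ ⟩
      entry B (i ∸ m)                          ≡⟨ entry-past m+1≤i ⟩
      entry σ i                                ∎
    where
    s = N + 1 ∸ i
    i<N+1 : i < N + 1
    i<N+1 = ≤-trans (s≤s i≤N) (≤-reflexive (+-comm 1 N))
    index : N + m + 1 ∸ i ≡ length A + s
    index = begin
      N + m + 1 ∸ i       ≡⟨ cong (λ x → x + 1 ∸ i) (+-comm N m) ⟩
      m + N + 1 ∸ i       ≡⟨ cong (_∸ i) (+-assoc m N 1) ⟩
      m + (N + 1) ∸ i     ≡⟨ +-∸-assoc m (<⇒≤ i<N+1) ⟩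
      m + s               ≡⟨ cong (_+ s) (sym |A|) ⟩
      length A + s        ∎
    s+j≡ : s + (i ∸ m) ≡ suc (length B)
    s+j≡ = begin
      s + (i ∸ m)         ≡⟨ m∸n+n∸o≡m∸o (<⇒≤ (m+1≤⇒m< m+1≤i)) (<⇒≤ i<N+1) ⟩
      N + 1 ∸ m           ≡⟨ +-∸-comm 1 m≤ ⟩
      N ∸ m + 1           ≡⟨ +-comm (N ∸ m) 1 ⟩
      suc (N ∸ m)         ≡⟨ cong suc (sym (length-drop m σ)) ⟩
      suc (length B)      ∎

  entry-reversePrefix-≤ : ∀ {i} → 1 ≤ i → i ≤ m → entry (reversePrefix m σ) (m + 1 ∸ i) ≡ entry σ i
  entry-reversePrefix-≤ {i} 1≤i i≤m = begin
      entry (reverse A ++ B) (m + 1 ∸ i)   ≡⟨ entry-++ˡ (reverse A) B (≤-trans s≤m (≤-reflexive (sym |rA|))) ⟩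
      entry (reverse A) (m + 1 ∸ i)        ≡⟨ entry-reverse A s+i≡ ⟩
      entry A i                            ≡⟨ entry-take m σ i≤m ⟩
      entry σ i                            ∎
    where
    s≤m : m + 1 ∸ i ≤ m
    s≤m = ≤-trans (∸-monoʳ-≤ (m + 1) 1≤i) (≤-reflexive (m+n∸n≡m m 1))
    s+i≡ : m + 1 ∸ i + i ≡ suc (length A)
    s+i≡ = trans (m∸n+n≡m (≤-trans i≤m (m≤m+n m 1))) (trans (+-comm m 1) (cong suc (sym |A|)))

  entry-reversePrefix-> : ∀ {i} → m + 1 ≤ i → entry (reversePrefix m σ) i ≡ entry σ i
  entry-reversePrefix-> {i} m+1≤i = begin
      entry (reverse A ++ B) i                               ≡⟨ cong (entry (reverse A ++ B)) i≡ ⟩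
      entry (reverse A ++ B) (length (reverse A) + (i ∸ m))  ≡⟨ entry-++ʳ (reverse A) B (m<n⇒0<n∸m m<i) ⟩
      entry B (i ∸ m)                                        ≡⟨ entry-past m+1≤i ⟩
      entry σ i                                              ∎
    where
    m<i = m+1≤⇒m< m+1≤i
    i≡ : i ≡ length (reverse A) + (i ∸ m)
    i≡ = trans (sym (m+[n∸m]≡n (<⇒≤ m<i))) (cong (_+ (i ∸ m)) (sym |rA|))

take-++-length : ∀ (xs ys : List ℕ) {m} → length xs ≡ m → take m (xs ++ ys) ≡ xs
take-++-length []       ys refl = refl
take-++-length (x ∷ xs) ys refl = cong (x ∷_) (take-++-length xs ys refl)

drop-++-length : ∀ (xs ys : List ℕ) {m} → length xs ≡ m → drop m (xs ++ ys) ≡ ys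
drop-++-length []       ys refl = refl
drop-++-length (x ∷ xs) ys refl = drop-++-length xs ys refl

module _ (m : ℕ) (xs : List ℕ) where
  private
    k = length xs ∸ m

    reverse-split : reverse xs ≡ reverse (drop k xs) ++ reverse (take k xs)
    reverse-split = trans (cong reverse (sym (take++drop≡id k xs))) (reverse-++ (take k xs) (drop k xs))

    |rD| : m ≤ length xs → length (reverse (drop k xs)) ≡ m
    |rD| m≤ = trans (length-reverse (drop k xs)) (trans (length-drop k xs) (m∸[m∸n]≡n m≤))

    k≡0 : length xs < m → k ≡ 0
    k≡0 m> = m≤n⇒m∸n≡0 (<⇒≤ m>)

    |rxs|≤ : length xs < m → length (reverse xs) ≤ m
    |rxs|≤ m> = ≤-trans (≤-reflexive (length-reverse xs)) (<⇒≤ m>)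

  take-reverse : take m (reverse xs) ≡ reverse (drop k xs)
  take-reverse with m ≤? length xs
  ... | yes m≤ = trans (cong (take m) reverse-split)
                       (take-++-length (reverse (drop k xs)) _ (|rD| m≤))
  ... | no m≰  rewrite k≡0 (≰⇒> m≰) = take-all m (reverse xs) (|rxs|≤ (≰⇒> m≰))

  drop-reverse : drop m (reverse xs) ≡ reverse (take k xs)
  drop-reverse with m ≤? length xs
  ... | yes m≤ = trans (cong (drop m) reverse-split)
                       (drop-++-length (reverse (drop k xs)) _ (|rD| m≤))
  ... | no m≰  rewrite k≡0 (≰⇒> m≰) = drop-all m (reverse xs) (|rxs|≤ (≰⇒> m≰))

reverse-T : ∀ σ → reverse (T σ) ≡ reverseSuffix (entry σ 1) σ
reverse-T σ = trans (reverse-++ (drop m σ) (reverse (take m σ)))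
                    (cong (_++ reverse (drop m σ)) (reverse-involutive (take m σ)))
  where m = entry σ 1

T-reverse : ∀ σ → T (reverse σ) ≡ reversePrefix (length σ ∸ entry σ (length σ)) σ
T-reverse σ = begin
    drop (entry (reverse σ) 1) (reverse σ) ++ reverse (take (entry (reverse σ) 1) (reverse σ))
  ≡⟨ cong (λ e → drop e (reverse σ) ++ reverse (take e (reverse σ))) (entry-reverse σ refl) ⟩
    drop e (reverse σ) ++ reverse (take e (reverse σ))
  ≡⟨ cong₂ (λ u v → u ++ reverse v) (drop-reverse e σ) (take-reverse e σ) ⟩
    reverse (take k σ) ++ reverse (reverse (drop k σ))
  ≡⟨ cong (reverse (take k σ) ++_) (reverse-involutive (drop k σ)) ⟩
    reversePrefix k σ ∎
  where
  open ≡-Reasoning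
  e = entry σ (length σ)
  k = length σ ∸ e

Tinv≡reverse∘T∘reverse : ∀ σ → Tinv σ ≡ reverse (T (reverse σ))
Tinv≡reverse∘T∘reverse σ = begin
    reverse (drop k σ) ++ take k σ
  ≡⟨ cong (reverse (drop k σ) ++_) (sym (reverse-involutive (take k σ))) ⟩
    reverse (drop k σ) ++ reverse (reverse (take k σ))
  ≡⟨ sym (reverse-++ (reverse (take k σ)) (drop k σ)) ⟩
    reverse (reversePrefix k σ)
  ≡⟨ cong reverse (sym (T-reverse σ)) ⟩
    reverse (T (reverse σ)) ∎
  where
  open ≡-Reasoning
  k = length σ ∸ entry σ (length σ)

T-++ : ∀ xs ys → entry (xs ++ ys) 1 ≡ length xs → T (xs ++ ys) ≡ ys ++ reverse xs
T-++ xs ys e≡ =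
  cong₂ (λ u v → u ++ reverse v) (drop-++-length xs ys (sym e≡)) (take-++-length xs ys (sym e≡))

T-reverse-T : ∀ x σ → 1 ≤ x → x ≤ length (x ∷ σ) → T (reverse (T (x ∷ σ))) ≡ reverse (x ∷ σ)
T-reverse-T x σ 1≤x x≤ = begin
    T (reverse (T τ))                     ≡⟨ cong T (reverse-T τ) ⟩
    T (A ++ reverse B)                    ≡⟨ T-++ A (reverse B) entry₁≡ ⟩
    reverse B ++ reverse A                ≡⟨ sym (reverse-++ A B) ⟩
    reverse (A ++ B)                      ≡⟨ cong reverse (take++drop≡id x τ) ⟩
    reverse τ                             ∎
  where
  open ≡-Reasoning
  τ = x ∷ σ
  A = take x τ
  B = drop x τ
  entry₁≡ : entry (A ++ reverse B) 1 ≡ length A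
  entry₁≡ = trans (entry-reverseSuffix-≤ τ x≤ 1≤x) (sym (length-take-≤ τ x≤))

reverse-short : ∀ (xs : List ℕ) → length xs ≤ 1 → reverse xs ≡ xs
reverse-short []          _ = refl
reverse-short (x ∷ [])    _ = refl
reverse-short (x ∷ y ∷ _) (s≤s ())

T≡reverse : ∀ σ → length σ ≤ entry σ 1 + 1 → T σ ≡ reverse σ
T≡reverse σ |σ|≤ = begin
    drop m σ ++ reverse (take m σ)             ≡⟨ cong (_++ reverse (take m σ)) (sym (reverse-short (drop m σ) |B|≤1)) ⟩
    reverse (drop m σ) ++ reverse (take m σ)   ≡⟨ sym (reverse-++ (take m σ) (drop m σ)) ⟩
    reverse (take m σ ++ drop m σ)             ≡⟨ cong reverse (take++drop≡id m σ) ⟩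
    reverse σ                                  ∎
  where
  open ≡-Reasoning
  m = entry σ 1
  |B|≤1 : length (drop m σ) ≤ 1
  |B|≤1 = ≤-trans (≤-reflexive (length-drop m σ)) (m≤n+o⇒m∸n≤o (length σ) m |σ|≤)

T-↭ : ∀ σ → T σ ↭ σ
T-↭ σ = begin
    drop m σ ++ reverse (take m σ)   ↭⟨ ++⁺ˡ (drop m σ) (↭-reverse (take m σ)) ⟩
    drop m σ ++ take m σ             ↭⟨ ++-comm (drop m σ) (take m σ) ⟩
    take m σ ++ drop m σ             ≡⟨ take++drop≡id m σ ⟩
    σ                                ∎
  where
  open PermutationReasoning
  m = entry σ 1

Tinv-↭ : ∀ σ → Tinv σ ↭ σ
Tinv-↭ σ = begin
    Tinv σ                    ≡⟨ Tinv≡reverse∘T∘reverse σ ⟩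
    reverse (T (reverse σ))   ↭⟨ ↭-reverse (T (reverse σ)) ⟩
    T (reverse σ)             ↭⟨ T-↭ (reverse σ) ⟩
    reverse σ                 ↭⟨ ↭-reverse σ ⟩
    σ                         ∎
  where open PermutationReasoning

iter-↭ : ∀ {f} → (∀ σ → f σ ↭ σ) → ∀ j σ → iter f j σ ↭ σ
iter-↭ f↭ zero    σ = ↭-reflexive refl
iter-↭ f↭ (suc j) σ = ↭-trans (f↭ _) (iter-↭ f↭ j σ)

Tpow-↭ : ∀ k σ → Tpow k σ ↭ σ
Tpow-↭ (+ j)      = iter-↭ T-↭ j
Tpow-↭ -[1+ j ]   = iter-↭ Tinv-↭ (suc j)

IsPerm-Tpow : ∀ {n σ} k → IsPerm n σ → IsPerm n (Tpow k σ)
IsPerm-Tpow {σ = σ} k p = ↭-trans (Tpow-↭ k σ) p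

IsPerm⇒length : ∀ {n σ} → IsPerm n σ → length σ ≡ n
IsPerm⇒length {n} p = trans (↭-length p) (trans (length-map suc (upTo n)) (length-upTo n))

IsPerm-head : ∀ {n x σ} → IsPerm n (x ∷ σ) → 1 ≤ x × x ≤ n
IsPerm-head p with ∈-map⁻ suc (∈-resp-↭ p (here refl))
... | _ , i∈ , refl = s≤s z≤n , ∈-upTo⁻ i∈

entry₁≤length : ∀ {n σ} → IsPerm n σ → entry σ 1 ≤ length σ
entry₁≤length {σ = []}    _ = z≤n
entry₁≤length {σ = _ ∷ _} p = ≤-trans (proj₂ (IsPerm-head p)) (≤-reflexive (sym (IsPerm⇒length p)))

T-reverse-T-perm : ∀ {n σ} → IsPerm n σ → T (reverse (T σ)) ≡ reverse σ
T-reverse-T-perm {σ = []}    _ = refl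
T-reverse-T-perm {σ = x ∷ σ} p = T-reverse-T x σ (proj₁ (IsPerm-head p)) (entry₁≤length p)

Tinv-T : ∀ {n σ} → IsPerm n σ → Tinv (T σ) ≡ σ
Tinv-T {σ = σ} p = begin
    Tinv (T σ)                    ≡⟨ Tinv≡reverse∘T∘reverse (T σ) ⟩
    reverse (T (reverse (T σ)))   ≡⟨ cong reverse (T-reverse-T-perm p) ⟩
    reverse (reverse σ)           ≡⟨ reverse-involutive σ ⟩
    σ                             ∎
  where open ≡-Reasoning

T-Tinv : ∀ {n σ} → IsPerm n σ → T (Tinv σ) ≡ σ
T-Tinv {σ = σ} p = begin
    T (Tinv σ)                              ≡⟨ cong T (Tinv≡reverse∘T∘reverse σ) ⟩
    T (reverse (T (reverse σ)))             ≡⟨ T-reverse-T-perm (↭-trans (↭-reverse σ) p) ⟩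
    reverse (reverse σ)                     ≡⟨ reverse-involutive σ ⟩
    σ                                       ∎
  where open ≡-Reasoning

iter-swap : ∀ (f : List ℕ → List ℕ) j σ → iter f j (f σ) ≡ f (iter f j σ)
iter-swap f zero    σ = refl
iter-swap f (suc j) σ = cong f (iter-swap f j σ)

iter-Tinv : ∀ j σ → iter Tinv j σ ≡ reverse (iter T j (reverse σ))
iter-Tinv zero    σ = sym (reverse-involutive σ)
iter-Tinv (suc j) σ = begin
    Tinv (iter Tinv j σ)                              ≡⟨ cong Tinv (iter-Tinv j σ) ⟩
    Tinv (reverse τ)                                  ≡⟨ Tinv≡reverse∘T∘reverse (reverse τ) ⟩
    reverse (T (reverse (reverse τ)))                 ≡⟨ cong (reverse ∘ T) (reverse-involutive τ) ⟩
    reverse (T τ)                                     ∎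
  where
  open ≡-Reasoning
  τ = iter T j (reverse σ)

Tpow-neg : ∀ k σ → Tpow (-ℤ k) σ ≡ reverse (Tpow k (reverse σ))
Tpow-neg (+ zero)  σ = sym (reverse-involutive σ)
Tpow-neg (+ suc j) σ = iter-Tinv (suc j) σ
Tpow-neg -[1+ j ]  σ = sym (begin
    reverse (iter Tinv (suc j) (reverse σ))                     ≡⟨ cong reverse (iter-Tinv (suc j) (reverse σ)) ⟩
    reverse (reverse (iter T (suc j) (reverse (reverse σ))))   ≡⟨ reverse-involutive _ ⟩
    iter T (suc j) (reverse (reverse σ))                       ≡⟨ cong (iter T (suc j)) (reverse-involutive σ) ⟩
    iter T (suc j) σ                                           ∎)
  where open ≡-Reasoning

module _ {n σ} (σ-perm : IsPerm n σ) where

  Tpow-suc : ∀ k → Tpow (1ℤ +ℤ k) σ ≡ T (Tpow k σ)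
  Tpow-suc (+ j)            = refl
  Tpow-suc -[1+ zero ]      = sym (T-Tinv σ-perm)
  Tpow-suc -[1+ suc j ]     = sym (T-Tinv (↭-trans (iter-↭ Tinv-↭ (suc j) σ) σ-perm))

  Tpow-T : ∀ k → Tpow k (T σ) ≡ T (Tpow k σ)
  Tpow-T (+ j)    = iter-swap T j σ
  Tpow-T -[1+ j ] = begin
      iter Tinv (suc j) (T σ)    ≡⟨ sym (iter-swap Tinv j (T σ)) ⟩
      iter Tinv j (Tinv (T σ))   ≡⟨ cong (iter Tinv j) (Tinv-T σ-perm) ⟩
      iter Tinv j σ              ≡⟨ sym (T-Tinv (↭-trans (iter-↭ Tinv-↭ j σ) σ-perm)) ⟩
      T (iter Tinv (suc j) σ)    ∎
    where open ≡-Reasoning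

T≡reverse-perm : ∀ {n π} → IsPerm n π → (entry π 1 ≡ n ⊎ entry π 1 ≡ n ∸ 1) → T π ≡ reverse π
T≡reverse-perm {n} {π} p π₁∈ = T≡reverse π (≤-trans (≤-reflexive (IsPerm⇒length p)) (n≤π₁+1 π₁∈))
  where
  n≤π₁+1 : entry π 1 ≡ n ⊎ entry π 1 ≡ n ∸ 1 → n ≤ entry π 1 + 1
  n≤π₁+1 (inj₁ π₁≡n)   = subst (λ x → n ≤ x + 1) (sym π₁≡n) (m≤m+n n 1)
  n≤π₁+1 (inj₂ π₁≡n-1) = subst (λ x → n ≤ x + 1) (sym π₁≡n-1) (≤-trans (m≤n+m∸n n 1) (≤-reflexive (+-comm 1 (n ∸ 1))))

module _ {n π} (π-perm : IsPerm n π) (Tπ≡reverseπ : T π ≡ reverse π) (k : ℤ) where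
  open ≡-Reasoning

  Tpow-neg≡reverse∘T : Tpow (-ℤ k) π ≡ reverse (T (Tpow k π))
  Tpow-neg≡reverse∘T = begin
      Tpow (-ℤ k) π                ≡⟨ Tpow-neg k π ⟩
      reverse (Tpow k (reverse π))  ≡⟨ cong (reverse ∘ Tpow k) (sym Tπ≡reverseπ) ⟩
      reverse (Tpow k (T π))        ≡⟨ cong reverse (Tpow-T π-perm k) ⟩
      reverse (T (Tpow k π))        ∎

  Tpow-2-neg≡T∘reverse : Tpow (-ℤ k +ℤ + 2) π ≡ T (reverse (Tpow k π))
  Tpow-2-neg≡T∘reverse = begin
      Tpow (-ℤ k +ℤ + 2) π              ≡⟨ cong (λ l → Tpow l π) (trans (ℤ.+-comm (-ℤ k) (+ 2)) (ℤ.+-assoc 1ℤ 1ℤ (-ℤ k))) ⟩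
      Tpow (1ℤ +ℤ (1ℤ +ℤ -ℤ k)) π       ≡⟨ Tpow-suc π-perm (1ℤ +ℤ -ℤ k) ⟩
      T (Tpow (1ℤ +ℤ -ℤ k) π)           ≡⟨ cong T (Tpow-suc π-perm (-ℤ k)) ⟩
      T (T (Tpow (-ℤ k) π))             ≡⟨ cong (T ∘ T) Tpow-neg≡reverse∘T ⟩
      T (T (reverse (T (Tpow k π))))    ≡⟨ cong T (T-reverse-T-perm (IsPerm-Tpow k π-perm)) ⟩
      T (reverse (Tpow k π))            ∎

theorem3p9 : (n : ℕ) → 2 ≤ n → (π : List ℕ) → IsPerm n π →
    (entry π 1 ≡ n ⊎ entry π 1 ≡ n ∸ 1) → (k : ℤ) →
    let π′ = Tpow k π
        π″ = Tpow (-ℤ k) π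
        π‴ = Tpow (-ℤ k +ℤ + 2) π
    in ((∀ i → 1 ≤ i → i ≤ entry π′ 1 → entry π′ i ≡ entry π″ i)
        × (∀ i → entry π′ 1 + 1 ≤ i → i ≤ n → entry π′ i ≡ entry π″ (n + entry π′ 1 + 1 ∸ i)))
       × ((∀ i → 1 ≤ i → i ≤ n ∸ entry π′ n → entry π′ i ≡ entry π‴ (n ∸ entry π′ n + 1 ∸ i))
        × (∀ i → n ∸ entry π′ n + 1 ≤ i → i ≤ n → entry π′ i ≡ entry π‴ i))
theorem3p9 n _ π π-perm π₁∈ k
  rewrite Tpow-neg≡reverse∘T π-perm (T≡reverse-perm π-perm π₁∈) k
        | Tpow-2-neg≡T∘reverse π-perm (T≡reverse-perm π-perm π₁∈) k
        | reverse-T (Tpow k π)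
        | T-reverse (Tpow k π)
        | sym (IsPerm⇒length (IsPerm-Tpow k π-perm))
  = ( (λ _ _ i≤m → sym (entry-reverseSuffix-≤ π′ m≤ i≤m))
    , (λ _ m+1≤i i≤N → sym (entry-reverseSuffix-> π′ m≤ m+1≤i i≤N)) )
  , ( (λ _ 1≤i i≤L → sym (entry-reversePrefix-≤ π′ L≤ 1≤i i≤L))
    , (λ _ L+1≤i _ → sym (entry-reversePrefix-> π′ L≤ L+1≤i)) )
  where
  π′ = Tpow k π
  m≤ : entry π′ 1 ≤ length π′
  m≤ = entry₁≤length (IsPerm-Tpow k π-perm)
  L≤ : length π′ ∸ entry π′ (length π′) ≤ length π′
  L≤ = m∸n≤m (length π′) (entry π′ (length π′))
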